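{- Let $G$ be a connected bipartite graph with a perfect matching $M$, and let $G_{\bar S}$ be a graph obtained from $G$ by a maximal sequence of contractions (as defined in the context). If $G$ is Spartan, then $G_{\bar S}$ is Spartan.
   Context: All graphs are finite, simple and undirected. $mvc(G)$ is the size of a minimum vertex cover. Eternal vertex cover game: a defender first places guards on vertices; in each round an attacker attacks an edge and the defender must move guards, each at most one step along an edge, so that at least one guard crosses the attacked edge; the defender wins if she can answer every attack of an infinite sequence. $evc(G)$ is the minimum number of guards for a defender win, and $G$ is Spartan if $evc(G)=mvc(G)$. An edge is allowed if it lies in a perfect matching; a graph is elementary if it is connected and every edge is allowed. Let $G$ be connected bipartite with bipartition $(A,B)$ and perfect matching $M=\{a_1b_1,\ldots,a_nb_n\}$ ($a_i\in A$, $b_i\in B$). A special subset is a set $S=\{a_{i_1},b_{i_1},\ldots,a_{i_k},b_{i_k}\}$ with distinct indices and $2\le k\le n$; it is a special elementary subset if $G[S]$ is elementary. For a special elementary subset $S$, the matching contraction graph $G_S$ is obtained by replacing $A\cap S$ by a new vertex $\alpha$ and $B\cap S$ by a new vertex $\beta$, adding the edge $\alpha\beta$, adding an edge $a\beta$ for every edge $ab$ of $G$ with $a\in A\setminus S$, $b\in S$, adding an edge $\alpha b$ for every edge $ab$ with $a\in S$, $b\in B\setminus S$, keeping all other vertices and edges, and merging parallel edges; $G_S$ is connected bipartite with perfect matching $(M\setminus E(G[S]))\cup\{\alpha\beta\}$. Contractions are repeated (each time w.r.t. the current perfect matching so obtained) until the current graph has no special elementary subset; the resulting graph is denoted $G_{\bar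 S}$. -}

module Defs where

open import Data.Nat using (ℕ; _≤_)
open import Data.Fin using (Fin)
open import Data.Fin.Subset using (Subset; ∣_∣) renaming (_∈_ to _∈ₛ_)
open import Data.Bool using (Bool; true)
open import Data.Sum using (_⊎_; inj₁; inj₂; [_,_])
open import Data.Product using (Σ; ∃; _×_; _,_)
open import Data.Empty using (⊥)
open import Data.Unit using (⊤)
open import Data.List using (List; length)
open import Data.List.Membership.Propositional using (_∈_)
open import Data.List.Relation.Unary.Unique.Propositional using (Unique)
open import Relation.Binary.PropositionalEquality using (_≡_)
open import Relation.Nullary using (¬_)
open import Function using (_⇔_; id)
open import Function.Definitions using (Injective)

module _ {V : Set} (Adj : V → V → Set) where

  -- vertex covers are duplicate-free lists of vertices; size = length
  IsVertexCover : List V → Set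
  IsVertexCover C = ∀ u v → Adj u v → (u ∈ C) ⊎ (v ∈ C)

  IsMVC : ℕ → Set
  IsMVC m = (Σ (List V) λ C → Unique C × length C ≡ m × IsVertexCover C)
          × (∀ C → Unique C → IsVertexCover C → m ≤ length C)

  -- Eternal vertex cover game with k (labelled) guards.
  -- A configuration assigns a vertex to each guard (at most one guard per vertex).
  Config : ℕ → Set
  Config k = Fin k → V

  Move : ∀ {k} → Config k → Config k → Set
  Move c c' = ∀ i → (c' i ≡ c i) ⊎ Adj (c i) (c' i)

  Crosses : ∀ {k} → Config k → Config k → V → V → Set
  Crosses c c' u v = ∃ λ i → ((c i ≡ u) × (c' i ≡ v)) ⊎ ((c i ≡ v) × (c' i ≡ u))

  -- The defender wins with k guards iff there is a nonempty family of
  -- configurations closed under answering every attack (winning strategy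
  -- for the infinite safety game).
  DefenderWins : ℕ → Set₁
  DefenderWins k =
    Σ (Config k → Set) λ W →
        (Σ (Config k) W)
      × (∀ c → W c → Injective _≡_ _≡_ c)
      × (∀ c → W c → ∀ u v → Adj u v →
           Σ (Config k) λ c' → W c' × Move c c' × Crosses c c' u v)

  IsEVC : ℕ → Set₁
  IsEVC e = DefenderWins e × (∀ k → DefenderWins k → e ≤ k)

  Spartan : Set₁
  Spartan = Σ ℕ λ m → IsMVC m × IsEVC m

  data Reach (P : V → Set) : V → V → Set where
    here  : ∀ {u} → Reach P u u
    step  : ∀ {u w v} → Adj u w → P w → Reach P w v → Reach P u v

  ConnectedOn : (V → Set) → Set
  ConnectedOn P = ∀ u v → P u → P v → Reach P u v

  Connected : Set
  Connected = ConnectedOn (λ _ → ⊤)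

-- Bipartite graphs with bipartition (A,B) and perfect matching
-- M = {a_i b_i : i : Fin n}.  A = inj₁ (Fin n), B = inj₂ (Fin n);
-- E i j = true  iff  a_i b_j is an edge.  M ⊆ E is the hypothesis
-- HasMatching.

BGraph : ℕ → Set
BGraph n = Fin n → Fin n → Bool

Vtx : ℕ → Set
Vtx n = Fin n ⊎ Fin n

BAdj : ∀ {n} → BGraph n → Vtx n → Vtx n → Set
BAdj E (inj₁ i) (inj₂ j) = E i j ≡ true
BAdj E (inj₂ j) (inj₁ i) = E i j ≡ true
BAdj E (inj₁ _) (inj₁ _) = ⊥
BAdj E (inj₂ _) (inj₂ _) = ⊥

HasMatching : ∀ {n} → BGraph n → Set
HasMatching E = ∀ i → E i i ≡ true

idx : ∀ {n} → Vtx n → Fin n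
idx = [ id , id ]

-- σ is a perfect matching of G[S], S = {a_i, b_i : i ∈ I}:
-- a_i is matched to b_{σ i}, σ a bijection of I along edges.
PerfectMatchingOn : ∀ {n} → BGraph n → Subset n → (Fin n → Fin n) → Set
PerfectMatchingOn E I σ =
    (∀ i → i ∈ₛ I → (σ i ∈ₛ I) × (E i (σ i) ≡ true))
  × (∀ i j → i ∈ₛ I → j ∈ₛ I → σ i ≡ σ j → i ≡ j)
  × (∀ j → j ∈ₛ I → ∃ λ i → (i ∈ₛ I) × (σ i ≡ j))

ElementaryOn : ∀ {n} → BGraph n → Subset n → Set
ElementaryOn E I =
    ConnectedOn (BAdj E) (λ v → idx v ∈ₛ I)
  × (∀ i j → i ∈ₛ I → j ∈ₛ I → E i j ≡ true →
       ∃ λ σ → PerfectMatchingOn E I σ × (σ i ≡ j))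

SpecialElementary : ∀ {n} → BGraph n → Subset n → Set
SpecialElementary E I = (2 ≤ ∣ I ∣) × ElementaryOn E I

NoSpecialElementary : ∀ {n} → BGraph n → Set
NoSpecialElementary {n} E = ∀ (I : Subset n) → ¬ SpecialElementary E I

-- H (on index set Fin m) is the matching contraction G_S for
-- S = {a_i,b_i : i ∈ I}, up to relabelling of indices: f sends every
-- index in I to the new index (α = a_{f i}, β = b_{f i}) and is a
-- bijection from the other indices onto the remaining indices; then
-- x y adjacent in H iff some preimages are adjacent in G (this gives
-- the edge αβ, the edges aβ, αb, the kept edges, parallel edges merged).
IsContraction : ∀ {n m} → BGraph n → Subset n → BGraph m → Set
IsContraction {n} {m} E I H =
  Σ (Fin n → Fin m) λ f →
      (∀ y → ∃ λ i → f i ≡ y)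
    × (∀ i j → i ∈ₛ I → j ∈ₛ I → f i ≡ f j)
    × (∀ i j → f i ≡ f j → (i ≡ j) ⊎ ((i ∈ₛ I) × (j ∈ₛ I)))
    × (∀ x y → (H x y ≡ true) ⇔ (∃ λ i → ∃ λ j → (f i ≡ x) × (f j ≡ y) × (E i j ≡ true)))

ContractStep : ∀ {n m} → BGraph n → BGraph m → Set
ContractStep {n} E H = Σ (Subset n) λ I → SpecialElementary E I × IsContraction E I H

data Contracts : ∀ {n m} → BGraph n → BGraph m → Set where
  done : ∀ {n} {E : BGraph n} → Contracts E E
  next : ∀ {n m k} {E : BGraph n} {F : BGraph m} {H : BGraph k} →
         ContractStep E F → Contracts F H → Contracts E H

MaximalContraction : ∀ {n m} → BGraph n → BGraph m → Set
MaximalContraction E H = Contracts E H × NoSpecialElementary H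

-- With mvc(G) ≤ n guards every matching edge a_z b_z carries exactly one guard. Write i → j when
-- a_i b_j is an edge, and let x₀ be minimal for reachability, so its ancestors form a source
-- component. Put a guard on b_{x₀}: then every ancestor z has a_z unguarded and b_z guarded, and if
-- an arc u → v left the ancestors, the attack on a_u b_v forces a guard from b_v to a_u. Following
-- each matched guard for one move is an injection on indices that maps ancestors to ancestors and
-- v to u, so v is an ancestor after all. As G is connected, → is strongly connected. Contractions
-- preserve this, and with at least two matching edges a strongly connected graph is itself special
-- elementary: an arc i → j closed up by a simple path j ⇝ i rotates into a perfect matching through
-- a_i b_j. So G_S̄ is K₂ or empty. Minimal elements exist only under ¬ ¬, which is enough here.

module Submission where

open import Data.Bool using (true)
open import Data.Empty using (⊥; ⊥-elim)
open import Data.Fin as Fin using (Fin; toℕ; _<_)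
open import Data.Fin.Permutation as Permutation
  using (Permutation′; _⟨$⟩ʳ_; _⟨$⟩ˡ_; inverseʳ; _∘ₚ_; transpose)
open import Data.Fin.Properties using (pigeonhole; injective⇒≤)
import Data.Fin.Subset as Sub
open import Data.Fin.Subset.Properties using (∈⊤; ∣⊤∣≡n)
open import Data.List using ([]; _∷_; length; tabulate)
open import Data.List.Membership.Propositional.Properties using (∈-tabulate⁺)
open import Data.List.Properties using (length-tabulate)
import Data.List.Relation.Unary.All as All
open import Data.List.Relation.Unary.AllPairs using ([]; _∷_)
open import Data.List.Relation.Unary.Any using (here)
open import Data.List.Relation.Unary.Unique.Propositional using (Unique)
open import Data.List.Relation.Unary.Unique.Propositional.Properties using (tabulate⁺)
open import Data.Nat as ℕ using (ℕ; zero; suc; _+_; _∸_)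
import Data.Nat.Properties as ℕ
open import Data.Product using (Σ; ∃; _×_; _,_; proj₁; proj₂)
open import Data.Sum using (_⊎_; inj₁; inj₂; [_,_])
open import Data.Sum.Properties using (inj₁-injective)
open import Data.Unit using (⊤; tt)
open import Data.Vec.Functional as Vector using (Vector)
open import Effect.Monad using (RawMonad)
open import Function.Base using (id; _∘_; const; case_of_)
open import Function.Bundles using (Equivalence; Injection)
open import Function.Definitions using (Injective)
import Function.Endo.Propositional as Endo
open import Function.Properties.Inverse using (↔⇒↣)
open import Level using (0ℓ)
open import Relation.Binary.Construct.Closure.ReflexiveTransitive using (Star; ε; _◅_; _◅◅_; gmap)
open import Relation.Binary.Core using (Rel)
open import Relation.Binary.Definitions using (Reflexive; Transitive)
open import Relation.Binary.PropositionalEquality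
  using (_≡_; _≢_; refl; sym; trans; cong; cong-app; subst; module ≡-Reasoning)
open import Relation.Nullary.Decidable using (Dec; yes; no; dec-true; dec-false; _⊎-dec_)
open import Relation.Nullary.Negation using (¬_; ¬¬-Monad; ¬¬-map; contradiction)
open import Relation.Unary using (Pred)

open import Defs

open RawMonad (¬¬-Monad {0ℓ})

private
  variable
    n m k : ℕ

¬¬-∀-Fin : {P : Fin n → Set} → (∀ i → ¬ ¬ P i) → ¬ ¬ (∀ i → P i)
¬¬-∀-Fin {zero}  _   = pure λ ()
¬¬-∀-Fin {suc n} ¬¬P = do
  P₀ ← ¬¬P Fin.zero
  P₊ ← ¬¬-∀-Fin (¬¬P ∘ Fin.suc)
  pure λ { Fin.zero → P₀ ; (Fin.suc i) → P₊ i }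

module _ {f : Fin n → Fin n} (f-injective : Injective _≡_ _≡_ f) where

  open Endo (Fin n) using (_^_; ^-homo)

  ^-injective : ∀ t → Injective _≡_ _≡_ (f ^ t)
  ^-injective zero    eq = eq
  ^-injective (suc t) eq = ^-injective t (f-injective eq)

  -- Pigeonhole on the orbit of x gives f ((f ^ d) x) ≡ x for some d.
  closed⇒preimage : (K : Pred (Fin n) 0ℓ) → (∀ {x} → K x → K (f x)) →
                    ∀ {x} → K x → ∃ λ y → K y × f y ≡ x
  closed⇒preimage K f-closed {x} x∈K
    with i , j , i<j , fⁱx≡fʲx ← pigeonhole (ℕ.n<1+n n) (λ t → (f ^ toℕ t) x) =
    (f ^ d) x , iterate-closed d , sym (^-injective (toℕ i) (begin
      (f ^ toℕ i) x                ≡⟨ fⁱx≡fʲx ⟩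
      (f ^ toℕ j) x                ≡⟨ cong (λ t → (f ^ t) x) (sym j≡i+1+d) ⟩
      (f ^ (toℕ i + suc d)) x      ≡⟨ cong-app (^-homo f (toℕ i) (suc d)) x ⟩
      (f ^ toℕ i) ((f ^ suc d) x)  ∎))
    where
    open ≡-Reasoning
    d = toℕ j ∸ suc (toℕ i)
    j≡i+1+d : toℕ i + suc d ≡ toℕ j
    j≡i+1+d = trans (ℕ.+-suc (toℕ i) d) (ℕ.m+[n∸m]≡n i<j)
    iterate-closed : ∀ t → K ((f ^ t) x)
    iterate-closed zero    = x∈K
    iterate-closed (suc t) = f-closed (iterate-closed t)

injective-missing⇒< : {f : Fin n → Fin k} → Injective _≡_ _≡_ f →
                      ∀ g → (∀ i → f i ≢ g) → n ℕ.< k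
injective-missing⇒< {f = f} f-injective g g∉f = injective⇒≤ g∷f-injective
  where
  g∷f-injective : Injective _≡_ _≡_ (g Vector.∷ f)
  g∷f-injective {Fin.zero}  {Fin.zero}  _  = refl
  g∷f-injective {Fin.zero}  {Fin.suc j} eq = contradiction (sym eq) (g∉f j)
  g∷f-injective {Fin.suc i} {Fin.zero}  eq = contradiction eq (g∉f i)
  g∷f-injective {Fin.suc i} {Fin.suc j} eq = cong Fin.suc (f-injective eq)

Minimal : Rel (Fin n) 0ℓ → Fin n → Set
Minimal _≲_ x = ∀ y → y ≲ x → x ≲ y

module _ {_≲_ : Rel (Fin n) 0ℓ} (≲-refl : Reflexive _≲_) (≲-trans : Transitive _≲_) where

  private
    _≺_ : Fin n → Fin n → Set
    y ≺ x = y ≲ x × ¬ x ≲ y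

    ≲-≺-trans : ∀ {x y z} → z ≲ y → y ≺ x → z ≺ x
    ≲-≺-trans z≲y (y≲x , x≴y) = ≲-trans z≲y y≲x , λ x≲z → x≴y (≲-trans x≲z z≲y)

    Descending : Vector (Fin n) k → Set
    Descending s = ∀ i j → i < j → s j ≺ s i

    ∷-descending : ∀ {x} {s : Vector (Fin n) k} →
                   (∀ i → s i ≺ x) → Descending s → Descending (x Vector.∷ s)
    ∷-descending s≺x _    Fin.zero    (Fin.suc j) _           = s≺x j
    ∷-descending _   desc (Fin.suc i) (Fin.suc j) (ℕ.s≤s i<j) = desc i j i<j

    -- ¬ ∀ gives ¬ ¬ ∃ ¬ here only because the domain is finite.
    below-non-minimal : ∀ x → ¬ Minimal _≲_ x → ¬ ¬ ∃ (_≺ x)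
    below-non-minimal x x-not-minimal none =
      ¬¬-∀-Fin (λ y ¬y≲x⇒x≲y → ¬y≲x⇒x≲y λ y≲x →
                  contradiction (y , y≲x , ¬y≲x⇒x≲y ∘ const) none)
               x-not-minimal

    chain : (∀ x → ¬ Minimal _≲_ x) →
            ∀ k x → ¬ ¬ ∃ λ (s : Vector (Fin n) k) → Descending (x Vector.∷ s)
    chain _          zero    x = pure ((λ ()) , ∷-descending (λ ()) λ ())
    chain no-minimal (suc k) x = do
      y , y≺x ← below-non-minimal x (no-minimal x)
      s , y∷s-descending ← chain no-minimal k y
      let s≺x i = ≲-≺-trans (proj₁ (y∷s-descending Fin.zero (Fin.suc i) ℕ.z<s)) y≺x
      pure (y Vector.∷ s ,
            ∷-descending (λ { Fin.zero → y≺x ; (Fin.suc i) → s≺x i }) y∷s-descending)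

  minimal-exists : Fin n → ¬ ¬ ∃ (Minimal _≲_)
  minimal-exists x no-minimal = chain (λ y y-minimal → no-minimal (y , y-minimal)) n x
    λ (s , descending) → let (i , j , i<j , sᵢ≡sⱼ) = pigeonhole (ℕ.n<1+n n) (x Vector.∷ s) in
      proj₂ (descending i j i<j) (subst ((x Vector.∷ s) i ≲_) sᵢ≡sⱼ ≲-refl)

Reach-trans : ∀ {V : Set} {Adj : V → V → Set} {P : V → Set} → Transitive (Reach Adj P)
Reach-trans here            r′ = r′
Reach-trans (step uw w∈P r) r′ = step uw w∈P (Reach-trans r r′)

-- Simple walks and rotations

transpose-ˡ : (i j : Fin n) → transpose i j ⟨$⟩ʳ i ≡ j
transpose-ˡ i j rewrite dec-true (i Fin.≟ i) refl = refl

transpose-ʳ : (i j : Fin n) → transpose i j ⟨$⟩ʳ j ≡ i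
transpose-ʳ i j with j Fin.≟ i
... | yes j≡i = j≡i
... | no  _   rewrite dec-true (j Fin.≟ j) refl = refl

transpose-other : ∀ {i j k : Fin n} → k ≢ i → k ≢ j → transpose i j ⟨$⟩ʳ k ≡ k
transpose-other {i = i} {j} {k} k≢i k≢j
  rewrite dec-false (k Fin.≟ i) k≢i | dec-false (k Fin.≟ j) k≢j = refl

module _ {T : Rel (Fin n) 0ℓ} where

  _∈ᵥ_ : ∀ {p q} → Fin n → Star T p q → Set
  _∈ᵥ_ {p} x ε       = x ≡ p
  _∈ᵥ_ {p} x (_ ◅ r) = x ≡ p ⊎ x ∈ᵥ r

  _∈ᵥ?_ : ∀ {p q} x (r : Star T p q) → Dec (x ∈ᵥ r)
  _∈ᵥ?_ {p} x ε       = x Fin.≟ p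
  _∈ᵥ?_ {p} x (_ ◅ r) = x Fin.≟ p ⊎-dec x ∈ᵥ? r

  start∈ᵥ : ∀ {p q} (r : Star T p q) → p ∈ᵥ r
  start∈ᵥ ε       = refl
  start∈ᵥ (_ ◅ _) = inj₁ refl

  Simple : ∀ {p q} → Star T p q → Set
  Simple ε             = ⊤
  Simple (_◅_ {p} _ r) = ¬ p ∈ᵥ r × Simple r

  suffix : ∀ {p q x} (r : Star T p q) → Simple r → x ∈ᵥ r → Σ (Star T x q) Simple
  suffix ε       _            refl        = ε , tt
  suffix (t ◅ r) simple       (inj₁ refl) = t ◅ r , simple
  suffix (_ ◅ r) (_ , simple) (inj₂ x∈r)  = suffix r simple x∈r

  simplify : ∀ {p q} → Star T p q → Σ (Star T p q) Simple
  simplify ε = ε , tt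
  simplify (_◅_ {p} t r) with r′ , simple ← simplify r with p ∈ᵥ? r′
  ... | yes p∈r′ = suffix r′ simple p∈r′
  ... | no  p∉r′ = t ◅ r′ , p∉r′ , simple

  -- On a simple walk p → w ⇝ q this is the cyclic permutation p ↦ w ↦ ⋯ ↦ q ↦ p.
  rotation : ∀ {p q} → Star T p q → Permutation′ n
  rotation ε                 = Permutation.id
  rotation (_◅_ {p} {w} _ r) = rotation r ∘ₚ transpose p w

  rotation-end : ∀ {p q} (r : Star T p q) → rotation r ⟨$⟩ʳ q ≡ p
  rotation-end ε                 = refl
  rotation-end (_◅_ {p} {w} _ r) =
    trans (cong (transpose p w ⟨$⟩ʳ_) (rotation-end r)) (transpose-ʳ p w)

  rotation-fixes : ∀ {p q x} (r : Star T p q) → ¬ x ∈ᵥ r → rotation r ⟨$⟩ʳ x ≡ x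
  rotation-fixes ε _ = refl
  rotation-fixes (_◅_ {p} {w} _ r) x∉ =
    trans (cong (transpose p w ⟨$⟩ʳ_) (rotation-fixes r (x∉ ∘ inj₂)))
          (transpose-other (x∉ ∘ inj₁) λ { refl → x∉ (inj₂ (start∈ᵥ r)) })

  rotation-injective : ∀ {p q} (r : Star T p q) → Injective _≡_ _≡_ (rotation r ⟨$⟩ʳ_)
  rotation-injective r = Injection.injective (↔⇒↣ (rotation r))

  rotation-step : Reflexive T → ∀ {p q} (r : Star T p q) → Simple r →
                  ∀ x → x ≢ q → T x (rotation r ⟨$⟩ʳ x)
  rotation-step T-refl ε _ x _ = T-refl
  rotation-step T-refl (_◅_ {p} {w} pw r) (p∉r , simple) x x≢q with x Fin.≟ p
  ... | yes refl = subst (T p) (sym σp≡w) pw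
    where
    σp≡w : rotation (pw ◅ r) ⟨$⟩ʳ p ≡ w
    σp≡w = trans (cong (transpose p w ⟨$⟩ʳ_) (rotation-fixes r p∉r)) (transpose-ˡ p w)
  ... | no  x≢p  =
    subst (T x) (sym (transpose-other σx≢p σx≢w)) (rotation-step T-refl r simple x x≢q)
    where
    σx≢p : rotation r ⟨$⟩ʳ x ≢ p
    σx≢p σx≡p = x≢p (rotation-injective r (trans σx≡p (sym (rotation-fixes r p∉r))))
    σx≢w : rotation r ⟨$⟩ʳ x ≢ w
    σx≢w σx≡w = x≢q (rotation-injective r (trans σx≡w (sym (rotation-end r))))

Arc : BGraph n → Rel (Fin n) 0ℓ
Arc E i j = E i j ≡ true

Walk : BGraph n → Rel (Fin n) 0ℓ
Walk E = Star (Arc E)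

StronglyConnected : BGraph n → Set
StronglyConnected E = ∀ i j → Walk E i j

A-side-cover : (G : BGraph n) → IsVertexCover (BAdj G) (tabulate inj₁)
A-side-cover G (inj₁ i) _        _  = inj₁ (∈-tabulate⁺ i)
A-side-cover G (inj₂ _) (inj₁ i) _  = inj₂ (∈-tabulate⁺ i)
A-side-cover G (inj₂ _) (inj₂ _) ()

mvc≤n : (G : BGraph n) → IsMVC (BAdj G) k → k ℕ.≤ n
mvc≤n {n} {k} G (_ , minimum) = subst (k ℕ.≤_) (length-tabulate inj₁)
  (minimum _ (tabulate⁺ inj₁-injective) (A-side-cover G))

step-from-B : (G : BGraph n) {x y : Vtx n} {z : Fin n} → x ≡ inj₂ z → y ≡ x ⊎ BAdj G x y →
              y ≡ inj₂ z ⊎ ∃ λ w → y ≡ inj₁ w × Arc G w z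
step-from-B G               refl (inj₁ stays) = inj₁ stays
step-from-B G {y = inj₁ w}  refl (inj₂ wz)    = inj₂ (w , refl , wz)
step-from-B G {y = inj₂ _}  refl (inj₂ ())

-- Winning strategies with at most n guards

module WinningStrategy (G : BGraph n) (matching : HasMatching G) (k≤n : k ℕ.≤ n)
  (W : Config (BAdj G) k → Set)
  (W-injective : ∀ c → W c → Injective _≡_ _≡_ c)
  (W-answers : ∀ c → W c → ∀ u v → BAdj G u v →
     Σ (Config (BAdj G) k) λ c' → W c' × Move (BAdj G) c c' × Crosses (BAdj G) c c' u v)
  where

  Guarded : Config (BAdj G) k → Vtx n → Set
  Guarded c v = ∃ λ g → c g ≡ v

  guards-cover : ∀ {c} → W c → ∀ {u v} → BAdj G u v → Guarded c u ⊎ Guarded c v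
  guards-cover {c} w {u} {v} uv with W-answers c w u v uv
  ... | _ , _ , _ , g , inj₁ (cg≡u , _) = inj₁ (g , cg≡u)
  ... | _ , _ , _ , g , inj₂ (cg≡v , _) = inj₂ (g , cg≡v)

  guard-on-matching-edge : ∀ {c} → W c → ∀ z → ∃ λ g → idx (c g) ≡ z
  guard-on-matching-edge w z with guards-cover w {inj₁ z} {inj₂ z} (matching z)
  ... | inj₁ (g , cg≡a) = g , cong idx cg≡a
  ... | inj₂ (g , cg≡b) = g , cong idx cg≡b

  matched-guard : ∀ {c} → W c → Fin n → Fin k
  matched-guard w z = proj₁ (guard-on-matching-edge w z)

  matched-guard-idx : ∀ {c} (w : W c) z → idx (c (matched-guard w z)) ≡ z
  matched-guard-idx w z = proj₂ (guard-on-matching-edge w z)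

  matched-guard-injective : ∀ {c} (w : W c) → Injective _≡_ _≡_ (matched-guard w)
  matched-guard-injective {c} w {y} {z} eq =
    trans (sym (matched-guard-idx w y)) (trans (cong (idx ∘ c) eq) (matched-guard-idx w z))

  second-guard : ∀ {c} (w : W c) {z g₁ g₂} → c g₁ ≡ inj₁ z → c g₂ ≡ inj₂ z →
                 ∃ λ g → idx (c g) ≡ z × g ≢ matched-guard w z
  second-guard w {z} {g₁} {g₂} cg₁≡a cg₂≡b with matched-guard w z Fin.≟ g₁
  ... | no  g₁-unmatched = g₁ , cong idx cg₁≡a , g₁-unmatched ∘ sym
  ... | yes g₁-matched   =
    g₂ , cong idx cg₂≡b , λ g₂-matched → g₁≢g₂ (trans (sym g₁-matched) (sym g₂-matched))
    where
    g₁≢g₂ : g₁ ≢ g₂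
    g₁≢g₂ refl = case trans (sym cg₁≡a) cg₂≡b of λ ()

  unmatched : ∀ {c} (w : W c) {z g} → idx (c g) ≡ z → g ≢ matched-guard w z →
              ∀ y → matched-guard w y ≢ g
  unmatched {c} w {z} cg≡z g-unmatched y g-matches-y =
    g-unmatched (trans (sym g-matches-y) (cong (matched-guard w) y≡z))
    where
    y≡z : y ≡ z
    y≡z = trans (sym (matched-guard-idx w y)) (trans (cong (idx ∘ c) g-matches-y) cg≡z)

  -- The n matched guards are distinct, so with k ≤ n guards no guard is left over.
  not-both-ends-guarded : ∀ {c} → W c → ∀ {z} → Guarded c (inj₁ z) → Guarded c (inj₂ z) → ⊥
  not-both-ends-guarded w (_ , cg₁≡a) (_ , cg₂≡b) =
    let g , cg≡z , g-unmatched = second-guard w cg₁≡a cg₂≡b in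
    ℕ.<⇒≱ (injective-missing⇒< (matched-guard-injective w) g (unmatched w cg≡z g-unmatched)) k≤n

  unguarded-along : ∀ {c} → W c → ∀ {p q} → Walk G p q →
                    ¬ Guarded c (inj₁ p) → ¬ Guarded c (inj₁ q)
  unguarded-along w ε                   a-free = a-free
  unguarded-along w (_◅_ {p} {r} pr rq) a-free = unguarded-along w rq λ aᵣ →
    [ a-free , (λ bᵣ → not-both-ends-guarded w aᵣ bᵣ) ] (guards-cover w {inj₁ p} {inj₂ r} pr)

  on-B-side : ∀ {c} → W c → ∀ {g z} → idx (c g) ≡ z → ¬ Guarded c (inj₁ z) → c g ≡ inj₂ z
  on-B-side {c} w {g} cg≡z a-free with c g in cg≡
  ... | inj₁ _ = ⊥-elim (a-free (g , trans cg≡ (cong inj₁ cg≡z)))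
  ... | inj₂ _ = cong inj₂ cg≡z

  idx-injective : ∀ {c} → W c → ∀ {g₁ g₂} → idx (c g₁) ≡ idx (c g₂) → g₁ ≡ g₂
  idx-injective {c} w {g₁} {g₂} eq = W-injective c w (same-vertex (c g₁) (c g₂) refl refl eq)
    where
    same-vertex : ∀ x y → c g₁ ≡ x → c g₂ ≡ y → idx x ≡ idx y → x ≡ y
    same-vertex (inj₁ _) (inj₁ _) _ _ eq = cong inj₁ eq
    same-vertex (inj₂ _) (inj₂ _) _ _ eq = cong inj₂ eq
    same-vertex (inj₁ _) (inj₂ _) a b refl = ⊥-elim (not-both-ends-guarded w (g₁ , a) (g₂ , b))
    same-vertex (inj₂ _) (inj₁ _) a b refl = ⊥-elim (not-both-ends-guarded w (g₂ , b) (g₁ , a))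

  B-guarded-configuration : ∀ {c} → W c → ∀ z → ∃ λ c' → W c' × Guarded c' (inj₂ z)
  B-guarded-configuration {c} w z with W-answers c w (inj₁ z) (inj₂ z) (matching z)
  ... | c' , w' , _ , g , inj₁ (_ , c'g≡b) = c' , w' , g , c'g≡b
  ... | _  , _  , _ , g , inj₂ (cg≡b , _)  = c , w , g , cg≡b

  module _ {x₀} (x₀-minimal : Minimal (Walk G) x₀) where

    Ancestor : Fin n → Set
    Ancestor z = Walk G z x₀

    ancestors-unguarded : ∀ {c} → W c → Guarded c (inj₂ x₀) →
                          ∀ {z} → Ancestor z → ¬ Guarded c (inj₁ z)
    ancestors-unguarded w b₀ z⇝x₀ =
      unguarded-along w (x₀-minimal _ z⇝x₀) (λ a₀ → not-both-ends-guarded w a₀ b₀)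

    crossing-guard : ∀ {s s'} → W s → W s' → Move (BAdj G) s s' → Guarded s (inj₂ x₀) →
                     ∀ {u v g} → Ancestor u → s g ≡ inj₂ v → s' g ≡ inj₁ u → Ancestor v
    crossing-guard {s} {s'} w w' move b₀ {u} {v} {g} u⇝x₀ sg≡b s'g≡a
      = let y , y⇝x₀ , ψy≡u = closed⇒preimage ψ-injective Ancestor ψ-closed u⇝x₀ in
        subst Ancestor (ψ-injective (trans ψy≡u (sym ψv≡u))) y⇝x₀
      where
      ψ : Fin n → Fin n
      ψ z = idx (s' (matched-guard w z))
      ψ-injective : Injective _≡_ _≡_ ψ
      ψ-injective = matched-guard-injective w ∘ idx-injective w'
      v-matched : matched-guard w v ≡ g
      v-matched = idx-injective w (trans (matched-guard-idx w v) (sym (cong idx sg≡b)))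
      ψv≡u : ψ v ≡ u
      ψv≡u = cong idx (trans (cong s' v-matched) s'g≡a)
      a₀-not-free : ¬ ¬ Guarded s' (inj₁ x₀)
      a₀-not-free a₀-free = unguarded-along w' (x₀-minimal u u⇝x₀) a₀-free (g , s'g≡a)
      ψ-closed : ∀ {z} → Ancestor z → Ancestor (ψ z)
      ψ-closed {z} z⇝x₀
        with step-from-B G (on-B-side w (matched-guard-idx w z) (ancestors-unguarded w b₀ z⇝x₀))
                           (move (matched-guard w z))
      ... | inj₁ stays =
        ⊥-elim (a₀-not-free (unguarded-along w' z⇝x₀ (λ a → not-both-ends-guarded w' a (_ , stays))))
      ... | inj₂ (y , moved , yz) = subst Ancestor (sym (cong idx moved)) (yz ◅ z⇝x₀)

    ancestors-closed : ∀ {c} → W c → ∀ {u v} → Ancestor u → Arc G u v → Ancestor v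
    ancestors-closed w {u} {v} u⇝x₀ uv
      with s , ws , b₀ ← B-guarded-configuration w x₀
      with W-answers s ws (inj₁ u) (inj₂ v) uv
    ... | _ , _ , _ , g , inj₁ (sg≡a , _) = ⊥-elim (ancestors-unguarded ws b₀ u⇝x₀ (g , sg≡a))
    ... | _ , ws' , move , g , inj₂ (sg≡b , s'g≡a) =
      crossing-guard ws ws' move b₀ u⇝x₀ sg≡b s'g≡a

    everything-reaches : Connected (BAdj G) → ∀ {c} → W c → ∀ z → Ancestor z
    everything-reaches connected w z = along (connected (inj₁ x₀) (inj₁ z) tt tt) ε
      where
      along : ∀ {x y} → Reach (BAdj G) (λ _ → ⊤) x y → Ancestor (idx x) → Ancestor (idx y)
      along here = id
      along {inj₁ _} (step {w = inj₂ _} pq _ rest) p⇝x₀ = along rest (ancestors-closed w p⇝x₀ pq)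
      along {inj₂ _} (step {w = inj₁ _} qp _ rest) p⇝x₀ = along rest (qp ◅ p⇝x₀)
      along {inj₁ _} (step {w = inj₁ _} () _ _)
      along {inj₂ _} (step {w = inj₂ _} () _ _)

  strongly-connected : Connected (BAdj G) → ∀ {c} → W c → ∀ {x₀} → Minimal (Walk G) x₀ →
                       StronglyConnected G
  strongly-connected connected w x₀-minimal p q =
    reaches p ◅◅ x₀-minimal q (reaches q)
    where reaches = everything-reaches x₀-minimal connected w

spartan⇒strongly-connected : (G : BGraph n) → HasMatching G → Connected (BAdj G) →
                             Spartan (BAdj G) → ¬ ¬ StronglyConnected G
spartan⇒strongly-connected {zero}  G _ _ _ = pure λ ()
spartan⇒strongly-connected {suc n} G matching connected
                           (k , k-mvc , (W , (c , w) , W-injective , W-answers) , _) = do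
  x₀ , x₀-minimal ← minimal-exists {_≲_ = Walk G} ε _◅◅_ Fin.zero
  pure (strongly-connected connected w x₀-minimal)
  where open WinningStrategy G matching (mvc≤n G k-mvc) W W-injective W-answers

-- Matching contractions

contraction-arc : ∀ {E : BGraph n} {I} {F : BGraph m} (c : IsContraction E I F) →
                  ∀ {i j} → Arc E i j → Arc F (proj₁ c i) (proj₁ c j)
contraction-arc (_ , _ , _ , _ , F⇔E) e = Equivalence.from (F⇔E _ _) (_ , _ , refl , refl , e)

step-preserves-matching : ∀ {E : BGraph n} {F : BGraph m} → ContractStep E F →
                          HasMatching E → HasMatching F
step-preserves-matching (_ , _ , c@(_ , f-surjective , _)) matching y
  with i , refl ← f-surjective y = contraction-arc c (matching i)

step-preserves-strongly-connected : ∀ {E : BGraph n} {F : BGraph m} → ContractStep E F →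
                                    StronglyConnected E → StronglyConnected F
step-preserves-strongly-connected (_ , _ , c@(f , f-surjective , _)) E-connected x y
  with i , refl ← f-surjective x | j , refl ← f-surjective y =
  gmap f (contraction-arc c) (E-connected i j)

Contracts-preserves : (P : ∀ {n} → BGraph n → Set) →
                      (∀ {n m} {E : BGraph n} {F : BGraph m} → ContractStep E F → P E → P F) →
                      ∀ {E : BGraph n} {H : BGraph m} → Contracts E H → P E → P H
Contracts-preserves P step-preserves done              = id
Contracts-preserves P step-preserves (next first rest) =
  Contracts-preserves P step-preserves rest ∘ step-preserves first

module _ {H : BGraph m} (matching : HasMatching H) (H-connected : StronglyConnected H) where

  private
    P : Vtx m → Set
    P v = idx v Sub.∈ Sub.⊤

    walk⇒reach : ∀ {p q} → Walk H p q → Reach (BAdj H) P (inj₁ p) (inj₁ q)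
    walk⇒reach ε                  = here
    walk⇒reach (_◅_ {j = w} pw r) =
      step {w = inj₂ w} pw ∈⊤ (step {w = inj₁ w} (matching w) ∈⊤ (walk⇒reach r))

    to-A : ∀ v → Reach (BAdj H) P v (inj₁ (idx v))
    to-A (inj₁ _) = here
    to-A (inj₂ p) = step {w = inj₁ p} (matching p) ∈⊤ here

    from-A : ∀ v → Reach (BAdj H) P (inj₁ (idx v)) v
    from-A (inj₁ _) = here
    from-A (inj₂ p) = step {w = inj₂ p} (matching p) ∈⊤ here

  strongly-connected⇒elementary : ElementaryOn H Sub.⊤
  strongly-connected⇒elementary = connected , arc-in-perfect-matching
    where
    connected : ConnectedOn (BAdj H) P
    connected u v _ _ =
      Reach-trans (to-A u) (Reach-trans (walk⇒reach (H-connected (idx u) (idx v))) (from-A v))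

    arc-in-perfect-matching : ∀ i j → i Sub.∈ Sub.⊤ → j Sub.∈ Sub.⊤ → Arc H i j →
                              ∃ λ σ → PerfectMatchingOn H Sub.⊤ σ × σ i ≡ j
    arc-in-perfect-matching i j _ _ ij with r , simple ← simplify (H-connected j i) =
      σ ⟨$⟩ʳ_ ,
      ( (λ x _ → ∈⊤ , arc x)
      , (λ _ _ _ _ → rotation-injective r)
      , (λ y _ → σ ⟨$⟩ˡ y , ∈⊤ , inverseʳ σ)) ,
      rotation-end r
      where
      σ = rotation r
      arc : ∀ x → Arc H x (σ ⟨$⟩ʳ x)
      arc x with x Fin.≟ i
      ... | yes refl = subst (Arc H x) (sym (rotation-end r)) ij
      ... | no  x≢i  = rotation-step (matching _) r simple x x≢i

empty-spartan : (H : BGraph 0) → Spartan (BAdj H)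
empty-spartan H =
  0 , (([] , [] , refl , λ { (inj₁ ()) ; (inj₂ ()) }) , λ _ _ _ → ℕ.z≤n) , (strategy , λ _ _ → ℕ.z≤n)
  where
  strategy : DefenderWins (BAdj H) 0
  strategy = (λ _ → ⊤) , ((λ ()) , tt) , (λ _ _ {}) , λ { _ _ (inj₁ ()) ; _ _ (inj₂ ()) }

module _ (H : BGraph 1) (matching : HasMatching H) where

  private
    a₀ b₀ : Vtx 1
    a₀ = inj₁ Fin.zero
    b₀ = inj₂ Fin.zero

    other-end : Vtx 1 → Vtx 1
    other-end (inj₁ Fin.zero) = b₀
    other-end (inj₂ Fin.zero) = a₀

    other-end-adjacent : ∀ x → BAdj H x (other-end x)
    other-end-adjacent (inj₁ Fin.zero) = matching Fin.zero
    other-end-adjacent (inj₂ Fin.zero) = matching Fin.zero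

    crosses : ∀ x {u v} → BAdj H u v → (x ≡ u × other-end x ≡ v) ⊎ (x ≡ v × other-end x ≡ u)
    crosses (inj₁ Fin.zero) {inj₁ Fin.zero} {inj₂ Fin.zero} _ = inj₁ (refl , refl)
    crosses (inj₂ Fin.zero) {inj₁ Fin.zero} {inj₂ Fin.zero} _ = inj₂ (refl , refl)
    crosses (inj₁ Fin.zero) {inj₂ Fin.zero} {inj₁ Fin.zero} _ = inj₂ (refl , refl)
    crosses (inj₂ Fin.zero) {inj₂ Fin.zero} {inj₁ Fin.zero} _ = inj₁ (refl , refl)

    cover : IsVertexCover (BAdj H) (a₀ ∷ [])
    cover (inj₁ Fin.zero) _               _  = inj₁ (here refl)
    cover (inj₂ Fin.zero) (inj₁ Fin.zero) _  = inj₂ (here refl)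
    cover (inj₂ Fin.zero) (inj₂ Fin.zero) ()

    cover-nonempty : ∀ C → Unique C → IsVertexCover (BAdj H) C → 1 ℕ.≤ length C
    cover-nonempty []      _ C-cover =
      case C-cover a₀ b₀ (matching Fin.zero) of λ { (inj₁ ()) ; (inj₂ ()) }
    cover-nonempty (_ ∷ _) _ _       = ℕ.s≤s ℕ.z≤n

    strategy : DefenderWins (BAdj H) 1
    strategy = (λ _ → ⊤) , ((λ _ → a₀) , tt) , (λ { _ _ {Fin.zero} {Fin.zero} _ → refl }) ,
               λ c _ u v uv → other-end ∘ c , tt , inj₂ ∘ other-end-adjacent ∘ c ,
                              Fin.zero , crosses (c Fin.zero) uv

    guard-needed : ∀ k → DefenderWins (BAdj H) k → 1 ℕ.≤ k
    guard-needed zero    (W , (c , w) , _ , answer) with answer c w a₀ b₀ (matching Fin.zero)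
    ... | _ , _ , _ , () , _
    guard-needed (suc _) _ = ℕ.s≤s ℕ.z≤n

  K₂-spartan : Spartan (BAdj H)
  K₂-spartan = 1 , ((a₀ ∷ [] , All.[] ∷ [] , refl , cover) , cover-nonempty) , (strategy , guard-needed)

no-special⇒spartan : (H : BGraph m) → HasMatching H → ¬ ¬ StronglyConnected H →
                     NoSpecialElementary H → Spartan (BAdj H)
no-special⇒spartan {zero}        H _        _                 _          = empty-spartan H
no-special⇒spartan {suc zero}    H matching _                 _          = K₂-spartan H matching
no-special⇒spartan {suc (suc m)} H matching ¬¬strongly-connected no-special =
  ⊥-elim (¬¬strongly-connected λ strongly-connected →
    no-special Sub.⊤ (subst (2 ℕ.≤_) (sym (∣⊤∣≡n (suc (suc m)))) (ℕ.s≤s (ℕ.s≤s ℕ.z≤n)) ,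
                      strongly-connected⇒elementary matching strongly-connected))

lemma13 : ∀ (n : ℕ) (G : BGraph n) → HasMatching G → Connected (BAdj G) →
          ∀ (m : ℕ) (H : BGraph m) → MaximalContraction G H →
          Spartan (BAdj G) → Spartan (BAdj H)
lemma13 n G G-matching G-connected m H (contractions , no-special) G-spartan =
  no-special⇒spartan H
    (Contracts-preserves HasMatching step-preserves-matching contractions G-matching)
    (¬¬-map (Contracts-preserves StronglyConnected step-preserves-strongly-connected contractions)
            (spartan⇒strongly-connected G G-matching G-connected G-spartan))
    no-special
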